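{- Let $G=(V,E)$ be a $3$-leaf power, let $C$ be a critical clique of $G$, and let $S\subseteq V$ with $C\setminus S\neq\emptyset$. If $C\setminus S$ is not a critical clique of the induced subgraph $G[V\setminus S]$, then the connected component of $G[V\setminus S]$ containing $C\setminus S$ is a clique.
   Context: Graphs are finite, undirected and loopless. A graph $G=(V,E)$ is a $3$-leaf power if there exists a tree $T$ whose set of leaves is $V$ such that for distinct $u,v\in V$, $\{u,v\}\in E$ iff the distance between $u$ and $v$ in $T$ is at most $3$. A module of $G$ is a set $S$ of vertices such that $N(x)\setminus S=N(y)\setminus S$ for all $x,y\in S$. A critical clique of $G$ is a clique which is a module and is inclusion-maximal with this property. -}

module Defs where

open import Data.Nat using (ℕ; zero; suc; _≤_)
open import Data.Bool using (Bool; true; false)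
open import Data.Fin using (Fin)
open import Data.Fin.Subset using (Subset; _∈_; _∉_; _⊆_; ⊤; _─_; Nonempty)
open import Data.List using (List; []; _∷_; _++_; [_]; length)
open import Data.List.Relation.Unary.Linked using (Linked)
open import Data.List.Relation.Unary.Unique.Propositional using (Unique)
open import Data.Product using (Σ; ∃; ∃-syntax; _×_; _,_)
open import Relation.Binary.PropositionalEquality using (_≡_; _≢_)
open import Relation.Nullary using (¬_)
open import Function.Definitions using (Injective)
open import Function.Bundles using (_⇔_)

record Graph (n : ℕ) : Set where
  field
    adj    : Fin n → Fin n → Bool
    sym    : ∀ x y → adj x y ≡ adj y x
    irrefl : ∀ x → adj x x ≡ false
open Graph public

module _ {n : ℕ} (G : Graph n) where

  Adj : Fin n → Fin n → Set
  Adj x y = adj G x y ≡ true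

  data Walk : Fin n → Fin n → ℕ → Set where
    here  : ∀ {x} → Walk x x zero
    step  : ∀ {x y z k} → Adj x y → Walk y z k → Walk x z (suc k)

  DistLe : ℕ → Fin n → Fin n → Set
  DistLe d x y = ∃[ k ] (k ≤ d × Walk x y k)

  Connected : Set
  Connected = ∀ x y → ∃[ k ] Walk x y k

  HasCycle : Set
  HasCycle = Σ (Fin n) λ x → Σ (List (Fin n)) λ vs →
               (2 ≤ length vs) × Unique (x ∷ vs) × Linked Adj (x ∷ vs ++ [ x ])

  IsTree : Set
  IsTree = Connected × ¬ HasCycle

  IsLeaf : Fin n → Set
  IsLeaf x = ∀ y z → Adj x y → Adj x z → y ≡ z

  -- Notions inside the induced subgraph G[W], for W ⊆ V.
  -- (For W = ⊤ these are the notions in G itself.)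

  IsCliqueIn : Subset n → Subset n → Set
  IsCliqueIn W S = S ⊆ W × (∀ x y → x ∈ S → y ∈ S → x ≢ y → Adj x y)

  IsModuleIn : Subset n → Subset n → Set
  IsModuleIn W S = S ⊆ W ×
    (∀ x y z → x ∈ S → y ∈ S → z ∈ W → z ∉ S → (Adj x z ⇔ Adj y z))

  IsCriticalCliqueIn : Subset n → Subset n → Set
  IsCriticalCliqueIn W C =
    IsCliqueIn W C × IsModuleIn W C ×
    (∀ D → IsCliqueIn W D → IsModuleIn W D → C ⊆ D → D ⊆ C)

  data WalkIn (W : Subset n) : Fin n → Fin n → Set where
    here : ∀ {x} → x ∈ W → WalkIn W x x
    step : ∀ {x y z} → x ∈ W → Adj x y → WalkIn W y z → WalkIn W x z

  ComponentIn : Subset n → Fin n → Fin n → Set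
  ComponentIn W x y = WalkIn W x y

  IsCliqueP : (Fin n → Set) → Set
  IsCliqueP K = ∀ y z → K y → K z → y ≢ z → Adj y z

  IsCriticalClique : Subset n → Set
  IsCriticalClique C = IsCriticalCliqueIn ⊤ C

Is3LeafPower : ∀ {n} → Graph n → Set
Is3LeafPower {n} G =
  Σ ℕ λ m → Σ (Graph m) λ T → IsTree T ×
  Σ (Fin n → Fin m) λ ι → Injective _≡_ _≡_ ι ×
    (∀ v → IsLeaf T (ι v)) × (∀ t → IsLeaf T t → ∃[ v ] ι v ≡ t) ×
    (∀ u v → u ≢ v → (Adj G u v ⇔ DistLe T 3 (ι u) (ι v)))

-- In a 3-leaf power every vertex u sits below a unique tree node, its parent p(u), and two
-- distinct vertices are adjacent iff their parents coincide or are adjacent in the tree. Suppose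
-- C ─ S is not a critical clique of G[V ─ S]: some clique module D of G[V ─ S] contains x ∈ C ─ S
-- and a vertex w ∉ C. If p(x) = p(w), then x and w are twins in G and C ∪ {w} would be a larger
-- clique module of G. Otherwise p(x) and p(w) are adjacent, x and w are twins in G[V ─ S], and
-- since a tree has no triangles no walk of G[V ─ S] from x can leave the vertices with parent
-- p(x) or p(w); these vertices form a clique.
module Submission where

open import Defs hiding (sym)
open import Data.Nat using (ℕ; _≤_; s≤s; z≤n)
open import Data.Bool using (true; _≟_)
open import Data.Fin using (Fin)
open import Data.Fin.Properties using () renaming (_≟_ to _≟ᶠ_)
open import Data.Fin.Subset using (Subset; _∈_; _∉_; _─_; ⊤; Nonempty; _⊆_; _∪_; ⁅_⁆; inside; outside)
open import Data.Fin.Subset.Properties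
  using (_∈?_; ∈⊤; x∈p∪q⁻; x∈p∪q⁺; x∈⁅x⁆; x∈⁅y⁆⇒x≡y; x∈p∧x∉q⇒x∈p─q; p─q⊆p)
open import Data.Vec.Base using (_∷_; here; there)
open import Data.List using ([]; _∷_)
open import Data.List.Relation.Unary.Linked using ([-]; _∷_)
open import Data.List.Relation.Unary.AllPairs using ([]; _∷_)
open import Data.List.Relation.Unary.All using ([]; _∷_)
open import Data.Product using (∃-syntax; _,_; proj₁; proj₂)
open import Data.Sum using (_⊎_; inj₁; inj₂)
open import Data.Empty using (⊥; ⊥-elim)
open import Relation.Binary.PropositionalEquality using (_≡_; _≢_; refl; sym; trans; subst; subst₂; ≢-sym)
open import Relation.Nullary using (¬_; yes; no; contradiction)
open import Function.Base using (_∘_)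
open import Function.Bundles using (_⇔_; mk⇔; Equivalence)

open Equivalence using (to; from)

x∈p─q⇒x∉q : ∀ {n} (p q : Subset n) {x} → x ∈ p ─ q → x ∉ q
x∈p─q⇒x∉q (_ ∷ p) (outside ∷ q) (there x∈p─q) (there x∈q) = x∈p─q⇒x∉q p q x∈p─q x∈q
x∈p─q⇒x∉q (_ ∷ p) (inside ∷ q)  (there x∈p─q) (there x∈q) = x∈p─q⇒x∉q p q x∈p─q x∈q

module _ {n} (G : Graph n) where

  Adj-sym : ∀ {u v} → Adj G u v → Adj G v u
  Adj-sym {u} {v} e = trans (Graph.sym G v u) e

  Adj⇒≢ : ∀ {u v} → Adj G u v → u ≢ v
  Adj⇒≢ {u} e refl with trans (sym e) (irrefl G u)
  ... | ()

  WalkIn-source : ∀ {W s t} → WalkIn G W s t → s ∈ W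
  WalkIn-source (here s∈W)     = s∈W
  WalkIn-source (step s∈W _ _) = s∈W

  TwinsIn : Subset n → Fin n → Fin n → Set
  TwinsIn W x w = ∀ u → u ∈ W → u ≢ x → u ≢ w → Adj G x u ⇔ Adj G w u

  TwinsIn-sym : ∀ {W x w} → TwinsIn W x w → TwinsIn W w x
  TwinsIn-sym twins u u∈W u≢w u≢x = mk⇔ (from (twins u u∈W u≢x u≢w)) (to (twins u u∈W u≢x u≢w))

  clique∧module⇒twins : ∀ {W D x w} → IsCliqueIn G W D → IsModuleIn G W D →
                        x ∈ D → w ∈ D → TwinsIn W x w
  clique∧module⇒twins {D = D} (_ , clique) (_ , module′) x∈D w∈D u u∈W u≢x u≢w with u ∈? D
  ... | yes u∈D = mk⇔ (λ _ → clique _ u w∈D u∈D (≢-sym u≢w)) (λ _ → clique _ u x∈D u∈D (≢-sym u≢x))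
  ... | no  u∉D = module′ _ _ u x∈D w∈D u∈W u∉D

  criticalClique-absorbsTwin : ∀ {W C x w} → IsCriticalCliqueIn G W C →
                               x ∈ C → w ∈ W → Adj G x w → TwinsIn W x w → w ∈ C
  criticalClique-absorbsTwin {W} {C} {x} {w} ((C⊆W , clique) , (_ , module′) , maximal) x∈C w∈W xw twins
    with w ∈? C
  ... | yes w∈C = w∈C
  ... | no  w∉C = maximal C∪w isClique isModule (x∈p∪q⁺ ∘ inj₁) (x∈p∪q⁺ (inj₂ (x∈⁅x⁆ w)))
    where
    C∪w : Subset n
    C∪w = C ∪ ⁅ w ⁆

    member : ∀ {a} → a ∈ C∪w → a ∈ C ⊎ a ≡ w
    member a∈ with x∈p∪q⁻ C ⁅ w ⁆ a∈
    ... | inj₁ a∈C = inj₁ a∈C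
    ... | inj₂ a∈w = inj₂ (x∈⁅y⁆⇒x≡y w a∈w)

    ⊆W : C∪w ⊆ W
    ⊆W a∈ with member a∈
    ... | inj₁ a∈C = C⊆W a∈C
    ... | inj₂ refl = w∈W

    Adj-w : ∀ a → a ∈ C → Adj G a w
    Adj-w a a∈C = to (module′ x a w x∈C a∈C w∈W w∉C) xw

    isClique : IsCliqueIn G W C∪w
    isClique = ⊆W , λ a b a∈ b∈ a≢b → go (member a∈) (member b∈) a≢b
      where
      go : ∀ {a b} → a ∈ C ⊎ a ≡ w → b ∈ C ⊎ b ≡ w → a ≢ b → Adj G a b
      go (inj₁ a∈C) (inj₁ b∈C) a≢b = clique _ _ a∈C b∈C a≢b
      go (inj₁ a∈C) (inj₂ refl) _  = Adj-w _ a∈C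
      go (inj₂ refl) (inj₁ b∈C) _  = Adj-sym (Adj-w _ b∈C)
      go (inj₂ refl) (inj₂ refl) a≢b = contradiction refl a≢b

    like-x : ∀ {a z} → a ∈ C∪w → z ∈ W → z ∉ C∪w → Adj G a z ⇔ Adj G x z
    like-x {z = z} a∈ z∈W z∉ with member a∈
    ... | inj₁ a∈C = module′ _ x z a∈C x∈C z∈W (λ z∈C → z∉ (x∈p∪q⁺ (inj₁ z∈C)))
    ... | inj₂ refl = TwinsIn-sym twins z z∈W
                        (λ { refl → z∉ (x∈p∪q⁺ (inj₂ (x∈⁅x⁆ w))) })
                        (λ { refl → z∉ (x∈p∪q⁺ (inj₁ x∈C)) })

    isModule : IsModuleIn G W C∪w
    isModule = ⊆W , λ a b z a∈ b∈ z∈W z∉ →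
      mk⇔ (λ az → from (like-x b∈ z∈W z∉) (to (like-x a∈ z∈W z∉) az))
          (λ bz → from (like-x a∈ z∈W z∉) (to (like-x b∈ z∈W z∉) bz))

  ─-isClique : ∀ {C} S → IsCliqueIn G ⊤ C → IsCliqueIn G (⊤ ─ S) (C ─ S)
  ─-isClique {C} S (_ , clique) =
    (λ a∈ → x∈p∧x∉q⇒x∈p─q ∈⊤ (x∈p─q⇒x∉q C S a∈)) ,
    λ a b a∈ b∈ → clique a b (p─q⊆p C S a∈) (p─q⊆p C S b∈)

  ─-isModule : ∀ {C} S → IsModuleIn G ⊤ C → IsModuleIn G (⊤ ─ S) (C ─ S)
  ─-isModule {C} S (_ , module′) =
    (λ a∈ → x∈p∧x∉q⇒x∈p─q ∈⊤ (x∈p─q⇒x∉q C S a∈)) ,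
    λ a b z a∈ b∈ z∈ z∉ → module′ a b z (p─q⊆p C S a∈) (p─q⊆p C S b∈) ∈⊤
                            (λ z∈C → z∉ (x∈p∧x∉q⇒x∈p─q z∈C (x∈p─q⇒x∉q ⊤ S z∈)))

TriangleFree : ∀ {m} → Graph m → Set
TriangleFree T = ∀ {a b c} → Adj T a b → Adj T b c → Adj T a c → ⊥

EqOrAdj : ∀ {m} → Graph m → Fin m → Fin m → Set
EqOrAdj T a b = a ≡ b ⊎ Adj T a b

-- G arises from T by putting a (possibly empty) clique in each node: bag u is the node holding u.
record CliqueBlowup {n} (G : Graph n) : Set where
  field
    {m}          : ℕ
    T            : Graph m
    triangleFree : TriangleFree T
    bag          : Fin n → Fin m
    Adj⇔bagsNear : ∀ {u w} → u ≢ w → Adj G u w ⇔ EqOrAdj T (bag u) (bag w)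

module _ {m} {T : Graph m} where

  acyclic⇒triangleFree : ¬ HasCycle T → TriangleFree T
  acyclic⇒triangleFree acyclic {a} {b} {c} ab bc ac = acyclic
    (a , b ∷ c ∷ [] , s≤s (s≤s z≤n) ,
     ((Adj⇒≢ T ab ∷ Adj⇒≢ T ac ∷ []) ∷ (Adj⇒≢ T bc ∷ []) ∷ [] ∷ []) ,
     (ab ∷ bc ∷ Adj-sym T ac ∷ [-]))

  Walk⇒neighbour : ∀ {a b k} → Walk T a b k → a ≢ b → ∃[ c ] Adj T a c
  Walk⇒neighbour here         a≢b = contradiction refl a≢b
  Walk⇒neighbour (step ac _) _   = _ , ac

  leaves-within-3⇒parents-near : ∀ {a b pa pb k} → IsLeaf T a → IsLeaf T b →
    Adj T a pa → Adj T b pb → a ≢ b → k ≤ 3 → Walk T a b k → EqOrAdj T pa pb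
  leaves-within-3⇒parents-near _ _ _ _ a≢b _ here = contradiction refl a≢b
  leaves-within-3⇒parents-near {a} {b} {pa} {pb} leaf-a leaf-b a-pa b-pb _ _ (step ab here) =
    inj₂ (subst₂ (Adj T) (sym (leaf-a pa b a-pa ab)) (sym (leaf-b pb a b-pb (Adj-sym T ab))) (Adj-sym T ab))
  leaves-within-3⇒parents-near {pa = pa} {pb} leaf-a leaf-b a-pa b-pb _ _ (step ac (step cb here)) =
    inj₁ (trans (leaf-a pa _ a-pa ac) (sym (leaf-b pb _ b-pb (Adj-sym T cb))))
  leaves-within-3⇒parents-near {pa = pa} {pb} leaf-a leaf-b a-pa b-pb _ _ (step ac (step cd (step db here))) =
    inj₂ (subst₂ (Adj T) (sym (leaf-a pa _ a-pa ac)) (sym (leaf-b pb _ b-pb (Adj-sym T db))) cd)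
  leaves-within-3⇒parents-near _ _ _ _ _ (s≤s (s≤s (s≤s ()))) (step _ (step _ (step _ (step _ _))))

  parents-near⇒within-3 : ∀ {a b pa pb} → Adj T a pa → Adj T b pb → EqOrAdj T pa pb → DistLe T 3 a b
  parents-near⇒within-3 a-pa b-pb (inj₁ refl) = 2 , s≤s (s≤s z≤n) , step a-pa (step (Adj-sym T b-pb) here)
  parents-near⇒within-3 a-pa b-pb (inj₂ pa-pb) =
    3 , s≤s (s≤s (s≤s z≤n)) , step a-pa (step pa-pb (step (Adj-sym T b-pb) here))

-- A leaf needs a second vertex to have a parent, hence the two distinct vertices x and w.
3-leaf-power⇒cliqueBlowup : ∀ {n} {G : Graph n} {x w : Fin n} → x ≢ w → Is3LeafPower G → CliqueBlowup G
3-leaf-power⇒cliqueBlowup {n} {G} {x} {w} x≢w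
  (m , T , (connected , acyclic) , ι , ι-injective , ι-leaf , _ , Adj⇔dist) =
  record { m = m ; T = T ; triangleFree = acyclic⇒triangleFree {T = T} acyclic
         ; bag = parent ; Adj⇔bagsNear = Adj⇔parentsNear }
  where
  other : ∀ u → ∃[ u′ ] u ≢ u′
  other u with u ≟ᶠ x
  ... | yes refl = w , x≢w
  ... | no  u≢x  = x , u≢x

  parentΣ : ∀ u → ∃[ p ] Adj T (ι u) p
  parentΣ u with other u
  ... | u′ , u≢u′ = Walk⇒neighbour (proj₂ (connected (ι u) (ι u′))) (λ e → u≢u′ (ι-injective e))

  parent : Fin n → Fin m
  parent u = proj₁ (parentΣ u)

  Adj⇔parentsNear : ∀ {u v} → u ≢ v → Adj G u v ⇔ EqOrAdj T (parent u) (parent v)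
  Adj⇔parentsNear {u} {v} u≢v = mk⇔
    (λ uv → let (_ , k≤3 , walk) = to (Adj⇔dist u v u≢v) uv in
      leaves-within-3⇒parents-near (ι-leaf u) (ι-leaf v) (proj₂ (parentΣ u)) (proj₂ (parentΣ v))
        (λ e → u≢v (ι-injective e)) k≤3 walk)
    (λ near → from (Adj⇔dist u v u≢v) (parents-near⇒within-3 (proj₂ (parentΣ u)) (proj₂ (parentΣ v)) near))

module _ {n} {G : Graph n} (B : CliqueBlowup G) where
  open CliqueBlowup B

  sameBag⇒twins : ∀ {x w} → bag x ≡ bag w → TwinsIn G ⊤ x w
  sameBag⇒twins {x} {w} eq u _ u≢x u≢w = mk⇔
    (λ xu → from (Adj⇔bagsNear (≢-sym u≢w)) (subst near-u eq (to (Adj⇔bagsNear (≢-sym u≢x)) xu)))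
    (λ wu → from (Adj⇔bagsNear (≢-sym u≢x)) (subst near-u (sym eq) (to (Adj⇔bagsNear (≢-sym u≢w)) wu)))
    where
    near-u : Fin m → Set
    near-u b = EqOrAdj T b (bag u)

  -- A node of T adjacent to both bag x and bag w would close a triangle.
  twin-neighbourBag : ∀ {W x w u} → Adj T (bag x) (bag w) → TwinsIn G W x w →
                      u ∈ W → Adj T (bag x) (bag u) → bag u ≡ bag w
  twin-neighbourBag {x = x} {w} {u} xw twins u∈W xu with u ≟ᶠ w
  ... | yes refl = refl
  ... | no  u≢w = bag-wu (to (Adj⇔bagsNear (≢-sym u≢w)) wu)
    where
    u≢x : u ≢ x
    u≢x refl = Adj⇒≢ T xu refl
    wu : Adj G w u
    wu = to (twins u u∈W u≢x u≢w) (from (Adj⇔bagsNear (≢-sym u≢x)) (inj₂ xu))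
    bag-wu : EqOrAdj T (bag w) (bag u) → bag u ≡ bag w
    bag-wu (inj₁ w≡u) = sym w≡u
    bag-wu (inj₂ wu)  = ⊥-elim (triangleFree xw wu xu)

  InBags : Fin n → Fin n → Fin n → Set
  InBags x w u = bag u ≡ bag x ⊎ bag u ≡ bag w

  twins-walk-staysInBags : ∀ {W x w s t} → Adj T (bag x) (bag w) → TwinsIn G W x w →
                           WalkIn G W s t → InBags x w s → InBags x w t
  twins-walk-staysInBags xw twins (here _) s∈ = s∈
  twins-walk-staysInBags {W} {x} {w} xw twins (step {y = y} _ sy walk) s∈ =
    twins-walk-staysInBags xw twins walk (next s∈ (to (Adj⇔bagsNear (Adj⇒≢ G sy)) sy))
    where
    y∈W : y ∈ W
    y∈W = WalkIn-source G walk
    next : ∀ {s} → InBags x w s → EqOrAdj T (bag s) (bag y) → InBags x w y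
    next s∈ (inj₁ eq) = subst (λ b → b ≡ bag x ⊎ b ≡ bag w) eq s∈
    next (inj₁ s-x) (inj₂ sy) =
      inj₂ (twin-neighbourBag xw twins y∈W (subst (λ b → Adj T b (bag y)) s-x sy))
    next (inj₂ s-w) (inj₂ sy) =
      inj₁ (twin-neighbourBag (Adj-sym T xw) (TwinsIn-sym G twins) y∈W (subst (λ b → Adj T b (bag y)) s-w sy))

  InBags-isClique : ∀ {x w} → Adj T (bag x) (bag w) → IsCliqueP G (InBags x w)
  InBags-isClique xw y z y∈ z∈ y≢z = from (Adj⇔bagsNear y≢z) (near y∈ z∈)
    where
    near : ∀ {y z} → InBags _ _ y → InBags _ _ z → EqOrAdj T (bag y) (bag z)
    near (inj₁ y-x) (inj₁ z-x) = inj₁ (trans y-x (sym z-x))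
    near (inj₁ y-x) (inj₂ z-w) = inj₂ (subst₂ (Adj T) (sym y-x) (sym z-w) xw)
    near (inj₂ y-w) (inj₁ z-x) = inj₂ (subst₂ (Adj T) (sym y-w) (sym z-x) (Adj-sym T xw))
    near (inj₂ y-w) (inj₂ z-w) = inj₁ (trans y-w (sym z-w))

  twins-componentIsClique : ∀ {W x w} → Adj T (bag x) (bag w) → TwinsIn G W x w →
                            IsCliqueP G (ComponentIn G W x)
  twins-componentIsClique xw twins y z x⇝y x⇝z =
    InBags-isClique xw y z (twins-walk-staysInBags xw twins x⇝y (inj₁ refl))
                           (twins-walk-staysInBags xw twins x⇝z (inj₁ refl))

extend-criticalClique-or-componentIsClique :
  ∀ {n} {G : Graph n} {W C D x w} → Is3LeafPower G → IsCriticalClique G C → x ∈ C →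
  IsCliqueIn G W D → IsModuleIn G W D → x ∈ D → w ∈ D →
  w ∈ C ⊎ IsCliqueP G (ComponentIn G W x)
extend-criticalClique-or-componentIsClique {G = G} {W} {C} {x = x} {w} leafPower critical x∈C cliqueD moduleD x∈D w∈D
  with x ≟ᶠ w
... | yes refl = inj₁ x∈C
... | no  x≢w = byBags (to (Adj⇔bagsNear x≢w) xw)
  where
  B : CliqueBlowup G
  B = 3-leaf-power⇒cliqueBlowup x≢w leafPower
  open CliqueBlowup B
  xw : Adj G x w
  xw = proj₂ cliqueD x w x∈D w∈D x≢w
  byBags : EqOrAdj T (bag x) (bag w) → w ∈ C ⊎ IsCliqueP G (ComponentIn G W x)
  byBags (inj₁ same)     = inj₁ (criticalClique-absorbsTwin G critical x∈C ∈⊤ xw (sameBag⇒twins B same))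
  byBags (inj₂ adjacent) = inj₂ (twins-componentIsClique B adjacent (clique∧module⇒twins G cliqueD moduleD x∈D w∈D))

mainTheorem3 : ∀ {n} (G : Graph n) (C S : Subset n) →
    Is3LeafPower G → IsCriticalClique G C → Nonempty (C ─ S) →
    ¬ IsCriticalCliqueIn G (⊤ ─ S) (C ─ S) →
    ∀ x → x ∈ (C ─ S) → IsCliqueP G (ComponentIn G (⊤ ─ S) x)
mainTheorem3 G C S leafPower critical@(cliqueC , moduleC , _) _ notCritical x x∈C─S y z x⇝y x⇝z y≢z
  with adj G y z ≟ true
... | yes yz = yz
... | no ¬yz = ⊥-elim (notCritical (─-isClique G S cliqueC , ─-isModule G S moduleC , maximal))
  where
  maximal : ∀ D → IsCliqueIn G (⊤ ─ S) D → IsModuleIn G (⊤ ─ S) D → C ─ S ⊆ D → D ⊆ C ─ S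
  maximal D cliqueD moduleD C─S⊆D {w} w∈D
    with extend-criticalClique-or-componentIsClique leafPower critical (p─q⊆p C S x∈C─S)
           cliqueD moduleD (C─S⊆D x∈C─S) w∈D
  ... | inj₁ w∈C = x∈p∧x∉q⇒x∈p─q w∈C (x∈p─q⇒x∉q ⊤ S (proj₁ cliqueD w∈D))
  ... | inj₂ clique = ⊥-elim (¬yz (clique y z x⇝y x⇝z y≢z))
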